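{- Let $m\ge3$ be odd and let $a$ be an integer with $1\le a<m/2$ and $\gcd(m,a)=1$. Then $G_{\alpha}(m;a,a,a)$ is a snark.
   Context: Let $G$ be the graph with the 11 vertices $A,B,A',B',v,x_1,\dots,x_6$ and the 14 edges $Av,\ vA',\ Ax_6,\ x_6x_2,\ x_6x_5,\ x_2x_4,\ x_2B,\ x_4x_3,\ x_4B',\ x_3A',\ x_3x_5,\ x_5x_1,\ x_1B,\ x_1B'$. For integers $m\ge 3$, $a,b$ with $1\le a,b\le m-1$ and $1\le c<m/2$, $G_{\alpha}(m;a,b,c)$ is the cubic graph with vertex set $\{u_i: u\in V(G),\ i\in\mathbb{Z}_m\}\cup\{w_i: i\in\mathbb{Z}_m\}$ and edges $u_iu'_i$ for every edge $uu'$ of $G$, spoke edges $v_iw_i$, loop edges $w_iw_{i+c}$, and connecting edges $A'_iA_{i+a}$, $B'_iB_{i+b}$ (indices mod $m$). A snark is a cubic graph with chromatic index 4. -}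

module Defs where

open import Data.Nat using (ℕ; _+_; NonZero)
open import Data.Nat.DivMod using (_mod_)
open import Data.Fin using (Fin; toℕ)
open import Data.Product using (_×_; _,_; ∃-syntax; Σ-syntax)
open import Data.Sum using (_⊎_)
open import Relation.Binary.PropositionalEquality using (_≡_; _≢_)
open import Relation.Nullary using (¬_)

Loopless : {V : Set} → (V → V → Set) → Set
Loopless {V} Adj = ∀ (x : V) → ¬ Adj x x

Cubic : {V : Set} → (V → V → Set) → Set
Cubic {V} Adj = ∀ (x : V) → ∃[ n₁ ] ∃[ n₂ ] ∃[ n₃ ]
  ( Adj x n₁ × Adj x n₂ × Adj x n₃
  × n₁ ≢ n₂ × n₁ ≢ n₃ × n₂ ≢ n₃
  × (∀ y → Adj x y → y ≡ n₁ ⊎ y ≡ n₂ ⊎ y ≡ n₃) )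

EdgeColourable : {V : Set} → (V → V → Set) → ℕ → Set
EdgeColourable {V} Adj k = Σ[ col ∈ (V → V → Fin k) ]
  ( (∀ x y → Adj x y → col x y ≡ col y x)
  × (∀ x y z → Adj x y → Adj x z → y ≢ z → col x y ≢ col x z) )

ChromaticIndex4 : {V : Set} → (V → V → Set) → Set
ChromaticIndex4 Adj = EdgeColourable Adj 4 × ¬ EdgeColourable Adj 3

Snark : {V : Set} → (V → V → Set) → Set
Snark Adj = Loopless Adj × Cubic Adj × ChromaticIndex4 Adj

-- The base graph G (11 vertices) plus the extra label w.

data Lbl : Set where
  A B A' B' v x₁ x₂ x₃ x₄ x₅ x₆ w : Lbl

data GEdge : Lbl → Lbl → Set where
  e-Av    : GEdge A v
  e-vA'   : GEdge v A'
  e-Ax6   : GEdge A x₆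
  e-x6x2  : GEdge x₆ x₂
  e-x6x5  : GEdge x₆ x₅
  e-x2x4  : GEdge x₂ x₄
  e-x2B   : GEdge x₂ B
  e-x4x3  : GEdge x₄ x₃
  e-x4B'  : GEdge x₄ B'
  e-x3A'  : GEdge x₃ A'
  e-x3x5  : GEdge x₃ x₅
  e-x5x1  : GEdge x₅ x₁
  e-x1B   : GEdge x₁ B
  e-x1B'  : GEdge x₁ B'

-- vertices of G_α(m;a,b,c): u_i is (u , i), w_i is (w , i), i ∈ ℤ_m = Fin m
Vα : ℕ → Set
Vα m = Lbl × Fin m

_⊕_ : {m : ℕ} .{{_ : NonZero m}} → Fin m → ℕ → Fin m
_⊕_ {m} i k = (toℕ i + k) mod m

data Eα (m : ℕ) .{{_ : NonZero m}} (a b c : ℕ) : Vα m → Vα m → Set where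
  internal : ∀ {u u'} → GEdge u u' → (i : Fin m) → Eα m a b c (u , i) (u' , i)
  spoke    : (i : Fin m) → Eα m a b c (v , i) (w , i)
  loopE    : (i : Fin m) → Eα m a b c (w , i) (w , i ⊕ c)
  connA    : (i : Fin m) → Eα m a b c (A' , i) (A , i ⊕ a)
  connB    : (i : Fin m) → Eα m a b c (B' , i) (B , i ⊕ b)

Gα : (m : ℕ) .{{_ : NonZero m}} (a b c : ℕ) → Vα m → Vα m → Set
Gα m a b c x y = Eα m a b c x y ⊎ Eα m a b c y x

-- Call the copy of G together with w_i block i; it is joined to block i + a by the
-- edges A'_i A_{i+a}, B'_i B_{i+a} and w_i w_{i+a}. A 4-edge-colouring is explicit:
-- a fixed colouring of every block together with a 3-colouring, avoiding the spoke
-- colour, of the cycles formed by the edges w_i w_{i+a}. In a 3-edge-colouring, the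
-- four-pole on x₁, …, x₆, B, B' forces x₆A to have the colour of the B-edge leaving
-- the block and x₃A' that of the B-edge entering it; then the vertices A, A', v and w
-- force the colour triples on the A-, B- and w-edges entering consecutive blocks to
-- have opposite twist. As m steps i ↦ i + a lead back to i and m is odd, this is
-- impossible.
module Submission where

open import Defs
open import Data.Nat using (ℕ; _≤_; _<_; _*_; _%_; NonZero)
open import Data.Nat.GCD using (gcd)
open import Relation.Binary.PropositionalEquality using (_≡_)

open import Data.Bool using (Bool; not)
import Data.Bool as Bool
open import Data.Bool.Properties using (not-involutive; not-¬; ¬-not)
open import Data.Empty using (⊥-elim)
open import Data.Fin using (Fin; toℕ; suc; _≟_)
open import Data.Fin.Patterns using (0F; 1F; 2F; 3F)
open import Data.Fin.Properties using (all?; suc-injective; toℕ-fromℕ<; toℕ-injective; toℕ<n)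
open import Data.Nat using (zero; suc; _+_; _∸_; _/_; _<?_; >-nonZero)
open import Data.Nat.DivMod
  using ( _mod_; m≡m%n+[m/n]*n; m%n%n≡m%n; [m+kn]%n≡m%n; m≤n⇒[n∸m]%m≡n%m; m<n⇒m%n≡m; %-distribˡ-+
        ; m/n≡1+[m∸n]/n )
open import Data.Nat.GeneralisedArithmetic using (iterate)
open import Data.Nat.Properties
  using ( +-assoc; +-identityʳ; +-cancelˡ-≡; *-comm; *-identityˡ; ≤-reflexive; ≤-trans; ≤-<-trans
        ; <⇒≤; <⇒≢; ≮⇒≥; m≤m+n; m≤n+m; m<m+n; +-mono-<; +-monoˡ-≤; +-monoˡ-<; ∸-monoˡ-≤; ∸-monoˡ-<
        ; m+n∸m≡n; m+n∸n≡m; m+[n∸m]≡n; m∸n+n≡m; module ≤-Reasoning )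
open import Data.Product using (_×_; _,_; proj₁; proj₂)
open import Data.Sum using (_⊎_; inj₁; inj₂)
open import Function using (_∘_)
open import Relation.Binary.PropositionalEquality
  using (_≢_; refl; sym; trans; cong; subst; module ≡-Reasoning)
open import Relation.Nullary using (¬_)
open import Relation.Nullary.Decidable
  using (Dec; yes; no; does; ¬?; _×-dec_; _→-dec_; from-yes)

-- Arithmetic in ℤ_m

module _ {m : ℕ} .{{_ : NonZero m}} where

  toℕ-⊕ : (i : Fin m) (k : ℕ) → toℕ (i ⊕ k) ≡ (toℕ i + k) % m
  toℕ-⊕ i k = toℕ-fromℕ< _

  m≤n<m+m⇒n%m≡n∸m : ∀ {n} → m ≤ n → n < m + m → n % m ≡ n ∸ m
  m≤n<m+m⇒n%m≡n∸m {n} m≤n n<m+m = begin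
    n % m        ≡⟨ m≤n⇒[n∸m]%m≡n%m m≤n ⟨
    (n ∸ m) % m  ≡⟨ m<n⇒m%n≡m n∸m<m ⟩
    n ∸ m        ∎
    where
    open ≡-Reasoning
    n∸m<m : n ∸ m < m
    n∸m<m = ≤-trans (∸-monoˡ-< n<m+m m≤n) (≤-reflexive (m+n∸m≡n m m))

  ⊕-assoc : (i : Fin m) (k l : ℕ) → (i ⊕ k) ⊕ l ≡ i ⊕ (k + l)
  ⊕-assoc i k l = toℕ-injective (begin
    toℕ ((i ⊕ k) ⊕ l)                  ≡⟨ toℕ-⊕ (i ⊕ k) l ⟩
    (toℕ (i ⊕ k) + l) % m              ≡⟨ cong (λ t → (t + l) % m) (toℕ-⊕ i k) ⟩
    ((toℕ i + k) % m + l) % m          ≡⟨ %-distribˡ-+ ((toℕ i + k) % m) l m ⟩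
    ((toℕ i + k) % m % m + l % m) % m  ≡⟨ cong (λ t → (t + l % m) % m) (m%n%n≡m%n (toℕ i + k) m) ⟩
    ((toℕ i + k) % m + l % m) % m      ≡⟨ %-distribˡ-+ (toℕ i + k) l m ⟨
    (toℕ i + k + l) % m                ≡⟨ cong (_% m) (+-assoc (toℕ i) k l) ⟩
    (toℕ i + (k + l)) % m              ≡⟨ toℕ-⊕ i (k + l) ⟨
    toℕ (i ⊕ (k + l))                  ∎)
    where open ≡-Reasoning

  ⊕-multiple : (i : Fin m) (n : ℕ) → i ⊕ (n * m) ≡ i
  ⊕-multiple i n = toℕ-injective (begin
    toℕ (i ⊕ (n * m))      ≡⟨ toℕ-⊕ i (n * m) ⟩
    (toℕ i + n * m) % m    ≡⟨ [m+kn]%n≡m%n (toℕ i) n m ⟩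
    toℕ i % m              ≡⟨ m<n⇒m%n≡m (toℕ<n i) ⟩
    toℕ i                  ∎)
    where open ≡-Reasoning

  ⊕-≢ : (i : Fin m) {k : ℕ} → 0 < k → k < m → i ⊕ k ≢ i
  ⊕-≢ i {k} 0<k k<m i⊕k≡i with toℕ i + k <? m
  ... | yes i+k<m = <⇒≢ (m<m+n (toℕ i) 0<k) (begin
    toℕ i              ≡⟨ cong toℕ i⊕k≡i ⟨
    toℕ (i ⊕ k)        ≡⟨ toℕ-⊕ i k ⟩
    (toℕ i + k) % m    ≡⟨ m<n⇒m%n≡m i+k<m ⟩
    toℕ i + k          ∎)
    where open ≡-Reasoning
  ... | no i+k≮m = <⇒≢ k<m (+-cancelˡ-≡ (toℕ i) k m (begin
    toℕ i + k              ≡⟨ m∸n+n≡m m≤i+k ⟨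
    toℕ i + k ∸ m + m      ≡⟨ cong (_+ m) wrapped ⟩
    toℕ i + m              ∎))
    where
    open ≡-Reasoning
    m≤i+k : m ≤ toℕ i + k
    m≤i+k = ≮⇒≥ i+k≮m
    wrapped : toℕ i + k ∸ m ≡ toℕ i
    wrapped = begin
      toℕ i + k ∸ m      ≡⟨ m≤n<m+m⇒n%m≡n∸m m≤i+k (+-mono-< (toℕ<n i) k<m) ⟨
      (toℕ i + k) % m    ≡⟨ toℕ-⊕ i k ⟨
      toℕ (i ⊕ k)        ≡⟨ cong toℕ i⊕k≡i ⟩
      toℕ i              ∎

odd-iterate-≢ : {X : Set} (f : X → X) (τ : X → Bool) → (∀ x → τ (f x) ≡ not (τ x)) →
  ∀ n → n % 2 ≡ 1 → ∀ x → iterate f x n ≢ x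
odd-iterate-≢ f τ τ-flips n n-odd x fⁿx≡x = not-¬ refl (begin
  τ x                               ≡⟨ cong τ fⁿx≡x ⟨
  τ (iterate f x n)                 ≡⟨ cong (λ k → τ (iterate f x k)) n≡1+2k ⟩
  τ (iterate f (f x) (n / 2 * 2))   ≡⟨ even-iterate (n / 2) (f x) ⟩
  τ (f x)                           ≡⟨ τ-flips x ⟩
  not (τ x)                         ∎)
  where
  open ≡-Reasoning
  n≡1+2k : n ≡ suc (n / 2 * 2)
  n≡1+2k = trans (m≡m%n+[m/n]*n n 2) (cong (_+ n / 2 * 2) n-odd)
  even-iterate : ∀ k y → τ (iterate f y (k * 2)) ≡ τ y
  even-iterate zero    y = refl
  even-iterate (suc k) y = begin
    τ (iterate f (f (f y)) (k * 2))  ≡⟨ even-iterate k (f (f y)) ⟩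
    τ (f (f y))                      ≡⟨ τ-flips (f y) ⟩
    not (τ (f y))                    ≡⟨ cong not (τ-flips y) ⟩
    not (not (τ y))                  ≡⟨ not-involutive (τ y) ⟩
    τ y                              ∎

alternate : ℕ → Fin 3
alternate zero          = 0F
alternate (suc zero)    = 1F
alternate (suc (suc n)) = alternate n

alternate-≢-suc : ∀ n → alternate n ≢ alternate (suc n)
alternate-≢-suc zero          ()
alternate-≢-suc (suc zero)    ()
alternate-≢-suc (suc (suc n)) = alternate-≢-suc n

alternate-≢-2F : ∀ n → alternate n ≢ 2F
alternate-≢-2F zero          ()
alternate-≢-2F (suc zero)    ()
alternate-≢-2F (suc (suc n)) = alternate-≢-2F n

-- 3-edge-colourings of one block

Distinct₃ : {A : Set} → A → A → A → Set
Distinct₃ x y z = x ≢ y × x ≢ z × y ≢ z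

Distinct₃-cong : {A : Set} {x x' y y' z z' : A} →
  x ≡ x' → y ≡ y' → z ≡ z' → Distinct₃ x y z → Distinct₃ x' y' z'
Distinct₃-cong refl refl refl d = d

distinct₃? : (x y z : Fin 3) → Dec (Distinct₃ x y z)
distinct₃? x y z = ¬? (x ≟ y) ×-dec ¬? (x ≟ z) ×-dec ¬? (y ≟ z)

rotate : Fin 3 → Fin 3
rotate 0F = 1F
rotate 1F = 2F
rotate 2F = 0F

-- For three distinct colours: whether they are in cyclic order; for a repeated
-- colour: whether it is the cyclic successor of the remaining one.
twist : Fin 3 → Fin 3 → Fin 3 → Bool
twist x y z with x ≟ y | y ≟ z | x ≟ z
... | yes _ | _     | _     = does (x ≟ rotate z)
... | no _  | yes _ | _     = does (y ≟ rotate x)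
... | no _  | no _  | yes _ = does (x ≟ rotate y)
... | no _  | no _  | no _  = does (y ≟ rotate x)

-- The quantifiers are interleaved with the vertex conditions so that deciding the
-- statement only explores partial proper colourings.
B-colours-cross :
  ∀ (x₆A x₆x₂ x₆x₅ : Fin 3) → Distinct₃ x₆A x₆x₂ x₆x₅ →
  ∀ (x₂x₄ x₂B : Fin 3) → Distinct₃ x₆x₂ x₂x₄ x₂B →
  ∀ (x₄x₃ x₄B' : Fin 3) → Distinct₃ x₂x₄ x₄x₃ x₄B' →
  ∀ (x₃A' x₃x₅ : Fin 3) → Distinct₃ x₄x₃ x₃A' x₃x₅ →
  ∀ (x₅x₁ : Fin 3) → Distinct₃ x₆x₅ x₃x₅ x₅x₁ →
  ∀ (x₁B x₁B' : Fin 3) → Distinct₃ x₅x₁ x₁B x₁B' →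
  ∀ (inB : Fin 3) → Distinct₃ x₂B x₁B inB →
  ∀ (outB : Fin 3) → Distinct₃ x₄B' x₁B' outB →
  x₆A ≡ outB × x₃A' ≡ inB
B-colours-cross = from-yes
  (all? λ x₆A → all? λ x₆x₂ → all? λ x₆x₅ → distinct₃? x₆A x₆x₂ x₆x₅ →-dec
   all? λ x₂x₄ → all? λ x₂B → distinct₃? x₆x₂ x₂x₄ x₂B →-dec
   all? λ x₄x₃ → all? λ x₄B' → distinct₃? x₂x₄ x₄x₃ x₄B' →-dec
   all? λ x₃A' → all? λ x₃x₅ → distinct₃? x₄x₃ x₃A' x₃x₅ →-dec
   all? λ x₅x₁ → distinct₃? x₆x₅ x₃x₅ x₅x₁ →-dec
   all? λ x₁B → all? λ x₁B' → distinct₃? x₅x₁ x₁B x₁B' →-dec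
   all? λ inB → distinct₃? x₂B x₁B inB →-dec
   all? λ outB → distinct₃? x₄B' x₁B' outB →-dec
   (x₆A ≟ outB ×-dec x₃A' ≟ inB))

-- The vertices A, A', v and w of a block, with the colours of x₆A and x₃A' replaced
-- according to B-colours-cross.
twist-reversal :
  ∀ (Av outB inA : Fin 3) → Distinct₃ Av outB inA →
  ∀ (A'v inB outA : Fin 3) → Distinct₃ A'v inB outA →
  ∀ (vw : Fin 3) → Distinct₃ Av A'v vw →
  ∀ (outW inW : Fin 3) → Distinct₃ vw outW inW →
  twist outA outB outW ≢ twist inA inB inW
twist-reversal = from-yes
  (all? λ Av → all? λ outB → all? λ inA → distinct₃? Av outB inA →-dec
   all? λ A'v → all? λ inB → all? λ outA → distinct₃? A'v inB outA →-dec
   all? λ vw → distinct₃? Av A'v vw →-dec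
   all? λ outW → all? λ inW → distinct₃? vw outW inW →-dec
   ¬? (twist outA outB outW Bool.≟ twist inA inB inW))

-- The graph G_α(m; a, a, a)

GEdge-irrefl : ∀ {u u'} → GEdge u u' → u ≢ u'
GEdge-irrefl () refl

module _ (m : ℕ) .{{_ : NonZero m}} (a : ℕ) (0<a : 0 < a) (2a<m : 2 * a < m) where

  a+a<m : a + a < m
  a+a<m = ≤-trans (≤-reflexive (cong (λ t → suc (a + t)) (sym (+-identityʳ a)))) 2a<m

  a<m : a < m
  a<m = ≤-<-trans (m≤m+n a a) a+a<m

  next prev : Fin m → Fin m
  next i = i ⊕ a
  prev i = i ⊕ (m ∸ a)

  next-prev : ∀ i → next (prev i) ≡ i
  next-prev i = begin
    (i ⊕ (m ∸ a)) ⊕ a  ≡⟨ ⊕-assoc i (m ∸ a) a ⟩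
    i ⊕ (m ∸ a + a)    ≡⟨ cong (i ⊕_) (trans (m∸n+n≡m (<⇒≤ a<m)) (sym (*-identityˡ m))) ⟩
    i ⊕ (1 * m)        ≡⟨ ⊕-multiple i 1 ⟩
    i                  ∎
    where open ≡-Reasoning

  prev-next : ∀ i → prev (next i) ≡ i
  prev-next i = begin
    (i ⊕ a) ⊕ (m ∸ a)  ≡⟨ ⊕-assoc i a (m ∸ a) ⟩
    i ⊕ (a + (m ∸ a))  ≡⟨ cong (i ⊕_) (trans (m+[n∸m]≡n (<⇒≤ a<m)) (sym (*-identityˡ m))) ⟩
    i ⊕ (1 * m)        ≡⟨ ⊕-multiple i 1 ⟩
    i                  ∎
    where open ≡-Reasoning

  a≤m∸a : a ≤ m ∸ a
  a≤m∸a = ≤-trans (≤-reflexive (sym (m+n∸n≡m a a))) (∸-monoˡ-≤ a (<⇒≤ a+a<m))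

  n+a<m : ∀ {n} → n < m ∸ a → n + a < m
  n+a<m n<m∸a = ≤-trans (+-monoˡ-< a n<m∸a) (≤-reflexive (m∸n+n≡m (<⇒≤ a<m)))

  next-≢ : ∀ i → next i ≢ i
  next-≢ i = ⊕-≢ i 0<a a<m

  next²-≢ : ∀ i → next (next i) ≢ i
  next²-≢ i eq = ⊕-≢ i (≤-trans 0<a (m≤m+n a a)) a+a<m (trans (sym (⊕-assoc i a a)) eq)

  next-≢-prev : ∀ i → next i ≢ prev i
  next-≢-prev i eq = next²-≢ i (trans (cong next eq) (next-prev i))

  iterate-next : ∀ n i → iterate next i n ≡ i ⊕ (n * a)
  iterate-next zero    i = sym (⊕-multiple i 0)
  iterate-next (suc n) i = begin
    iterate next (next i) n  ≡⟨ iterate-next n (next i) ⟩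
    (i ⊕ a) ⊕ (n * a)        ≡⟨ ⊕-assoc i a (n * a) ⟩
    i ⊕ (a + n * a)          ∎
    where open ≡-Reasoning

  next-period : ∀ i → iterate next i m ≡ i
  next-period i = begin
    iterate next i m  ≡⟨ iterate-next m i ⟩
    i ⊕ (m * a)       ≡⟨ cong (i ⊕_) (*-comm m a) ⟩
    i ⊕ (a * m)       ≡⟨ ⊕-multiple i a ⟩
    i                 ∎
    where open ≡-Reasoning

  Adj : Vα m → Vα m → Set
  Adj = Gα m a a a

  N₁ N₂ N₃ : Vα m → Vα m
  N₁ (A  , i) = v  , i
  N₁ (A' , i) = v  , i
  N₁ (B  , i) = x₂ , i
  N₁ (B' , i) = x₄ , i
  N₁ (v  , i) = A  , i
  N₁ (x₁ , i) = x₅ , i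
  N₁ (x₂ , i) = x₆ , i
  N₁ (x₃ , i) = x₄ , i
  N₁ (x₄ , i) = x₂ , i
  N₁ (x₅ , i) = x₆ , i
  N₁ (x₆ , i) = A  , i
  N₁ (w  , i) = v  , i

  N₂ (A  , i) = x₆ , i
  N₂ (A' , i) = x₃ , i
  N₂ (B  , i) = x₁ , i
  N₂ (B' , i) = x₁ , i
  N₂ (v  , i) = A' , i
  N₂ (x₁ , i) = B  , i
  N₂ (x₂ , i) = x₄ , i
  N₂ (x₃ , i) = A' , i
  N₂ (x₄ , i) = x₃ , i
  N₂ (x₅ , i) = x₃ , i
  N₂ (x₆ , i) = x₂ , i
  N₂ (w  , i) = w  , next i

  N₃ (A  , i) = A' , prev i
  N₃ (A' , i) = A  , next i
  N₃ (B  , i) = B' , prev i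
  N₃ (B' , i) = B  , next i
  N₃ (v  , i) = w  , i
  N₃ (x₁ , i) = B' , i
  N₃ (x₂ , i) = B  , i
  N₃ (x₃ , i) = x₅ , i
  N₃ (x₄ , i) = B' , i
  N₃ (x₅ , i) = x₁ , i
  N₃ (x₆ , i) = x₅ , i
  N₃ (w  , i) = w  , prev i

  adj-from-prev : ∀ {p q} → (∀ j → Eα m a a a (p , j) (q , next j)) →
    ∀ i → Adj (q , i) (p , prev i)
  adj-from-prev {p} {q} edge i =
    inj₂ (subst (λ j → Eα m a a a (p , prev i) (q , j)) (next-prev i) (edge (prev i)))

  N₁-adj : ∀ x → Adj x (N₁ x)
  N₁-adj (A  , i) = inj₁ (internal e-Av i)
  N₁-adj (A' , i) = inj₂ (internal e-vA' i)
  N₁-adj (B  , i) = inj₂ (internal e-x2B i)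
  N₁-adj (B' , i) = inj₂ (internal e-x4B' i)
  N₁-adj (v  , i) = inj₂ (internal e-Av i)
  N₁-adj (x₁ , i) = inj₂ (internal e-x5x1 i)
  N₁-adj (x₂ , i) = inj₂ (internal e-x6x2 i)
  N₁-adj (x₃ , i) = inj₂ (internal e-x4x3 i)
  N₁-adj (x₄ , i) = inj₂ (internal e-x2x4 i)
  N₁-adj (x₅ , i) = inj₂ (internal e-x6x5 i)
  N₁-adj (x₆ , i) = inj₂ (internal e-Ax6 i)
  N₁-adj (w  , i) = inj₂ (spoke i)

  N₂-adj : ∀ x → Adj x (N₂ x)
  N₂-adj (A  , i) = inj₁ (internal e-Ax6 i)
  N₂-adj (A' , i) = inj₂ (internal e-x3A' i)
  N₂-adj (B  , i) = inj₂ (internal e-x1B i)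
  N₂-adj (B' , i) = inj₂ (internal e-x1B' i)
  N₂-adj (v  , i) = inj₁ (internal e-vA' i)
  N₂-adj (x₁ , i) = inj₁ (internal e-x1B i)
  N₂-adj (x₂ , i) = inj₁ (internal e-x2x4 i)
  N₂-adj (x₃ , i) = inj₁ (internal e-x3A' i)
  N₂-adj (x₄ , i) = inj₁ (internal e-x4x3 i)
  N₂-adj (x₅ , i) = inj₂ (internal e-x3x5 i)
  N₂-adj (x₆ , i) = inj₁ (internal e-x6x2 i)
  N₂-adj (w  , i) = inj₁ (loopE i)

  N₃-adj : ∀ x → Adj x (N₃ x)
  N₃-adj (A  , i) = adj-from-prev connA i
  N₃-adj (A' , i) = inj₁ (connA i)
  N₃-adj (B  , i) = adj-from-prev connB i
  N₃-adj (B' , i) = inj₁ (connB i)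
  N₃-adj (v  , i) = inj₁ (spoke i)
  N₃-adj (x₁ , i) = inj₁ (internal e-x1B' i)
  N₃-adj (x₂ , i) = inj₁ (internal e-x2B i)
  N₃-adj (x₃ , i) = inj₁ (internal e-x3x5 i)
  N₃-adj (x₄ , i) = inj₁ (internal e-x4B' i)
  N₃-adj (x₅ , i) = inj₁ (internal e-x5x1 i)
  N₃-adj (x₆ , i) = inj₁ (internal e-x6x5 i)
  N₃-adj (w  , i) = adj-from-prev loopE i

  Neighbour : Vα m → Vα m → Set
  Neighbour x y = y ≡ N₁ x ⊎ y ≡ N₂ x ⊎ y ≡ N₃ x

  pattern is-N₁ = inj₁ refl
  pattern is-N₂ = inj₂ (inj₁ refl)
  pattern is-N₃ = inj₂ (inj₂ refl)

  tail-neighbour : ∀ {x y} → Eα m a a a x y → Neighbour x y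
  tail-neighbour (internal e-Av _)   = is-N₁
  tail-neighbour (internal e-vA' _)  = is-N₂
  tail-neighbour (internal e-Ax6 _)  = is-N₂
  tail-neighbour (internal e-x6x2 _) = is-N₂
  tail-neighbour (internal e-x6x5 _) = is-N₃
  tail-neighbour (internal e-x2x4 _) = is-N₂
  tail-neighbour (internal e-x2B _)  = is-N₃
  tail-neighbour (internal e-x4x3 _) = is-N₂
  tail-neighbour (internal e-x4B' _) = is-N₃
  tail-neighbour (internal e-x3A' _) = is-N₂
  tail-neighbour (internal e-x3x5 _) = is-N₃
  tail-neighbour (internal e-x5x1 _) = is-N₃
  tail-neighbour (internal e-x1B _)  = is-N₂
  tail-neighbour (internal e-x1B' _) = is-N₃
  tail-neighbour (spoke _)           = is-N₃
  tail-neighbour (loopE _)           = is-N₂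
  tail-neighbour (connA _)           = is-N₃
  tail-neighbour (connB _)           = is-N₃

  head-neighbour : ∀ {x y} → Eα m a a a x y → Neighbour y x
  head-neighbour (internal e-Av _)   = is-N₁
  head-neighbour (internal e-vA' _)  = is-N₁
  head-neighbour (internal e-Ax6 _)  = is-N₁
  head-neighbour (internal e-x6x2 _) = is-N₁
  head-neighbour (internal e-x6x5 _) = is-N₁
  head-neighbour (internal e-x2x4 _) = is-N₁
  head-neighbour (internal e-x2B _)  = is-N₁
  head-neighbour (internal e-x4x3 _) = is-N₁
  head-neighbour (internal e-x4B' _) = is-N₁
  head-neighbour (internal e-x3A' _) = is-N₂
  head-neighbour (internal e-x3x5 _) = is-N₂
  head-neighbour (internal e-x5x1 _) = is-N₁
  head-neighbour (internal e-x1B _)  = is-N₂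
  head-neighbour (internal e-x1B' _) = is-N₂
  head-neighbour (spoke _)           = is-N₁
  head-neighbour (loopE i)           = inj₂ (inj₂ (cong (w  ,_) (sym (prev-next i))))
  head-neighbour (connA i)           = inj₂ (inj₂ (cong (A' ,_) (sym (prev-next i))))
  head-neighbour (connB i)           = inj₂ (inj₂ (cong (B' ,_) (sym (prev-next i))))

  neighbours-complete : ∀ {x y} → Adj x y → Neighbour x y
  neighbours-complete (inj₁ e) = tail-neighbour e
  neighbours-complete (inj₂ e) = head-neighbour e

  neighbours-distinct : ∀ x → Distinct₃ (N₁ x) (N₂ x) (N₃ x)
  neighbours-distinct (A  , i) = (λ ()) , (λ ()) , (λ ())
  neighbours-distinct (A' , i) = (λ ()) , (λ ()) , (λ ())
  neighbours-distinct (B  , i) = (λ ()) , (λ ()) , (λ ())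
  neighbours-distinct (B' , i) = (λ ()) , (λ ()) , (λ ())
  neighbours-distinct (v  , i) = (λ ()) , (λ ()) , (λ ())
  neighbours-distinct (x₁ , i) = (λ ()) , (λ ()) , (λ ())
  neighbours-distinct (x₂ , i) = (λ ()) , (λ ()) , (λ ())
  neighbours-distinct (x₃ , i) = (λ ()) , (λ ()) , (λ ())
  neighbours-distinct (x₄ , i) = (λ ()) , (λ ()) , (λ ())
  neighbours-distinct (x₅ , i) = (λ ()) , (λ ()) , (λ ())
  neighbours-distinct (x₆ , i) = (λ ()) , (λ ()) , (λ ())
  neighbours-distinct (w  , i) = (λ ()) , (λ ()) , next-≢-prev i ∘ cong proj₂

  Eα-irrefl : ∀ {x y} → Eα m a a a x y → x ≢ y
  Eα-irrefl (internal e _) eq = GEdge-irrefl e (cong proj₁ eq)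
  Eα-irrefl (spoke _)      ()
  Eα-irrefl (loopE i)      eq = next-≢ i (sym (cong proj₂ eq))
  Eα-irrefl (connA _)      ()
  Eα-irrefl (connB _)      ()

  loopless : Loopless Adj
  loopless x (inj₁ e) = Eα-irrefl e refl
  loopless x (inj₂ e) = Eα-irrefl e refl

  cubic : Cubic Adj
  cubic x with neighbours-distinct x
  ... | d₁₂ , d₁₃ , d₂₃ =
    N₁ x , N₂ x , N₃ x , N₁-adj x , N₂-adj x , N₃-adj x , d₁₂ , d₁₃ , d₂₃ , λ _ → neighbours-complete

  LocallyDistinct : {C : Set} → (Vα m → Vα m → C) → Set
  LocallyDistinct col = ∀ x → Distinct₃ (col x (N₁ x)) (col x (N₂ x)) (col x (N₃ x))

  Proper : {C : Set} → (Vα m → Vα m → C) → Set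
  Proper col = ∀ x y z → Adj x y → Adj x z → y ≢ z → col x y ≢ col x z

  locally-distinct⇒proper : {C : Set} (col : Vα m → Vα m → C) → LocallyDistinct col → Proper col
  locally-distinct⇒proper col distinct x y z x~y x~z y≢z
    with neighbours-complete x~y | neighbours-complete x~z | distinct x
  ... | is-N₁ | is-N₁ | _           = ⊥-elim (y≢z refl)
  ... | is-N₁ | is-N₂ | d₁₂ , _ , _ = d₁₂
  ... | is-N₁ | is-N₃ | _ , d₁₃ , _ = d₁₃
  ... | is-N₂ | is-N₁ | d₁₂ , _ , _ = d₁₂ ∘ sym
  ... | is-N₂ | is-N₂ | _           = ⊥-elim (y≢z refl)
  ... | is-N₂ | is-N₃ | _ , _ , d₂₃ = d₂₃
  ... | is-N₃ | is-N₁ | _ , d₁₃ , _ = d₁₃ ∘ sym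
  ... | is-N₃ | is-N₂ | _ , _ , d₂₃ = d₂₃ ∘ sym
  ... | is-N₃ | is-N₃ | _           = ⊥-elim (y≢z refl)

  proper⇒locally-distinct : {C : Set} (col : Vα m → Vα m → C) → Proper col → LocallyDistinct col
  proper⇒locally-distinct col proper x with neighbours-distinct x
  ... | d₁₂ , d₁₃ , d₂₃ =
      proper x _ _ (N₁-adj x) (N₂-adj x) d₁₂
    , proper x _ _ (N₁-adj x) (N₃-adj x) d₁₃
    , proper x _ _ (N₂-adj x) (N₃-adj x) d₂₃

  -- A 4-edge-colouring

  private instance
    a-nonZero : NonZero a
    a-nonZero = >-nonZero 0<a

  -- Below m ∸ a the colours alternate in runs of length a, so n and n + a differ; the
  -- top a indices, whose successors wrap around below a, get the third colour.
  cycleColour : ℕ → Fin 3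
  cycleColour n with n <? m ∸ a
  ... | yes _ = alternate (n / a)
  ... | no  _ = 2F

  cycleColour-below : ∀ {n} → n < m ∸ a → cycleColour n ≡ alternate (n / a)
  cycleColour-below {n} n<m∸a with n <? m ∸ a
  ... | yes _      = refl
  ... | no n≮m∸a   = ⊥-elim (n≮m∸a n<m∸a)

  cycleColour-above : ∀ {n} → ¬ n < m ∸ a → cycleColour n ≡ 2F
  cycleColour-above {n} n≮m∸a with n <? m ∸ a
  ... | yes n<m∸a  = ⊥-elim (n≮m∸a n<m∸a)
  ... | no _       = refl

  [n+a]%m<m∸a : ∀ {n} → n < m → ¬ n < m ∸ a → (n + a) % m < m ∸ a
  [n+a]%m<m∸a {n} n<m n≮m∸a = begin-strict
    (n + a) % m   ≡⟨ m≤n<m+m⇒n%m≡n∸m m≤n+a (+-mono-< n<m a<m) ⟩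
    n + a ∸ m     <⟨ ∸-monoˡ-< (+-monoˡ-< a n<m) m≤n+a ⟩
    m + a ∸ m     ≡⟨ m+n∸m≡n m a ⟩
    a             ≤⟨ a≤m∸a ⟩
    m ∸ a         ∎
    where
    open ≤-Reasoning
    m≤n+a : m ≤ n + a
    m≤n+a = ≤-trans (≤-reflexive (sym (m∸n+n≡m (<⇒≤ a<m)))) (+-monoˡ-≤ a (≮⇒≥ n≮m∸a))

  cycleColour-step : ∀ {n} → n < m → cycleColour n ≢ cycleColour ((n + a) % m)
  cycleColour-step {n} n<m = by-cases (n <? m ∸ a) (n + a <? m ∸ a)
    where
    open ≡-Reasoning
    by-cases : Dec (n < m ∸ a) → Dec (n + a < m ∸ a) → cycleColour n ≢ cycleColour ((n + a) % m)
    by-cases (yes n<m∸a) (yes n+a<m∸a) eq = alternate-≢-suc (n / a) (begin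
      alternate (n / a)           ≡⟨ cycleColour-below n<m∸a ⟨
      cycleColour n               ≡⟨ eq ⟩
      cycleColour ((n + a) % m)   ≡⟨ cong cycleColour (m<n⇒m%n≡m (n+a<m n<m∸a)) ⟩
      cycleColour (n + a)         ≡⟨ cycleColour-below n+a<m∸a ⟩
      alternate ((n + a) / a)     ≡⟨ cong alternate (m/n≡1+[m∸n]/n (m≤n+m a n)) ⟩
      alternate (suc ((n + a ∸ a) / a)) ≡⟨ cong (λ k → alternate (suc (k / a))) (m+n∸n≡m n a) ⟩
      alternate (suc (n / a))     ∎)
    by-cases (yes n<m∸a) (no n+a≮m∸a) eq = alternate-≢-2F (n / a) (begin
      alternate (n / a)           ≡⟨ cycleColour-below n<m∸a ⟨
      cycleColour n               ≡⟨ eq ⟩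
      cycleColour ((n + a) % m)   ≡⟨ cong cycleColour (m<n⇒m%n≡m (n+a<m n<m∸a)) ⟩
      cycleColour (n + a)         ≡⟨ cycleColour-above n+a≮m∸a ⟩
      2F                          ∎)
    by-cases (no n≮m∸a) _ eq = alternate-≢-2F ((n + a) % m / a) (begin
      alternate ((n + a) % m / a) ≡⟨ cycleColour-below ([n+a]%m<m∸a n<m n≮m∸a) ⟨
      cycleColour ((n + a) % m)   ≡⟨ eq ⟨
      cycleColour n               ≡⟨ cycleColour-above n≮m∸a ⟩
      2F                          ∎)

  loopColour : Fin m → Fin 3
  loopColour i = cycleColour (toℕ i)

  loopColour-next : ∀ i → loopColour i ≢ loopColour (next i)
  loopColour-next i eq = cycleColour-step (toℕ<n i) (trans eq (cong cycleColour (toℕ-⊕ i a)))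

  wColour : Fin m → Fin m → Fin 3
  wColour i j with j ≟ next i
  ... | yes _ = loopColour i
  ... | no  _ = loopColour j

  wColour-next : ∀ i → wColour i (next i) ≡ loopColour i
  wColour-next i with next i ≟ next i
  ... | yes _      = refl
  ... | no ≢refl   = ⊥-elim (≢refl refl)

  wColour-other : ∀ i j → j ≢ next i → wColour i j ≡ loopColour j
  wColour-other i j j≢next with j ≟ next i
  ... | yes j≡next = ⊥-elim (j≢next j≡next)
  ... | no _       = refl

  blockColour : Lbl → Lbl → Fin 4
  blockColour A  v  = 1F
  blockColour v  A  = 1F
  blockColour v  A' = 2F
  blockColour A' v  = 2F
  blockColour A  x₆ = 2F
  blockColour x₆ A  = 2F
  blockColour x₆ x₂ = 0F
  blockColour x₂ x₆ = 0F
  blockColour x₆ x₅ = 1F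
  blockColour x₅ x₆ = 1F
  blockColour x₂ x₄ = 1F
  blockColour x₄ x₂ = 1F
  blockColour x₂ B  = 2F
  blockColour B  x₂ = 2F
  blockColour x₄ x₃ = 0F
  blockColour x₃ x₄ = 0F
  blockColour x₄ B' = 2F
  blockColour B' x₄ = 2F
  blockColour x₃ A' = 1F
  blockColour A' x₃ = 1F
  blockColour x₃ x₅ = 2F
  blockColour x₅ x₃ = 2F
  blockColour x₅ x₁ = 0F
  blockColour x₁ x₅ = 0F
  blockColour x₁ B  = 1F
  blockColour B  x₁ = 1F
  blockColour x₁ B' = 3F
  blockColour B' x₁ = 3F
  -- the connecting edges and the spoke, which get colour 0, and non-adjacent pairs
  blockColour _  _  = 0F

  colour₄ : Vα m → Vα m → Fin 4
  colour₄ (w , i) (w , j) = suc (wColour i j)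
  colour₄ (p , _) (q , _) = blockColour p q

  colour₄-sym : ∀ {x y} → Eα m a a a x y → colour₄ x y ≡ colour₄ y x
  colour₄-sym (internal e-Av _)   = refl
  colour₄-sym (internal e-vA' _)  = refl
  colour₄-sym (internal e-Ax6 _)  = refl
  colour₄-sym (internal e-x6x2 _) = refl
  colour₄-sym (internal e-x6x5 _) = refl
  colour₄-sym (internal e-x2x4 _) = refl
  colour₄-sym (internal e-x2B _)  = refl
  colour₄-sym (internal e-x4x3 _) = refl
  colour₄-sym (internal e-x4B' _) = refl
  colour₄-sym (internal e-x3A' _) = refl
  colour₄-sym (internal e-x3x5 _) = refl
  colour₄-sym (internal e-x5x1 _) = refl
  colour₄-sym (internal e-x1B _)  = refl
  colour₄-sym (internal e-x1B' _) = refl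
  colour₄-sym (spoke _)           = refl
  colour₄-sym (connA _)           = refl
  colour₄-sym (connB _)           = refl
  colour₄-sym (loopE i)           = cong suc (begin
    wColour i (next i)   ≡⟨ wColour-next i ⟩
    loopColour i         ≡⟨ wColour-other (next i) i (next²-≢ i ∘ sym) ⟨
    wColour (next i) i   ∎)
    where open ≡-Reasoning

  colour₄-symmetric : ∀ x y → Adj x y → colour₄ x y ≡ colour₄ y x
  colour₄-symmetric _ _ (inj₁ e) = colour₄-sym e
  colour₄-symmetric _ _ (inj₂ e) = sym (colour₄-sym e)

  colour₄-locally-distinct : LocallyDistinct colour₄
  colour₄-locally-distinct (A  , i) = (λ ()) , (λ ()) , (λ ())
  colour₄-locally-distinct (A' , i) = (λ ()) , (λ ()) , (λ ())
  colour₄-locally-distinct (B  , i) = (λ ()) , (λ ()) , (λ ())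
  colour₄-locally-distinct (B' , i) = (λ ()) , (λ ()) , (λ ())
  colour₄-locally-distinct (v  , i) = (λ ()) , (λ ()) , (λ ())
  colour₄-locally-distinct (x₁ , i) = (λ ()) , (λ ()) , (λ ())
  colour₄-locally-distinct (x₂ , i) = (λ ()) , (λ ()) , (λ ())
  colour₄-locally-distinct (x₃ , i) = (λ ()) , (λ ()) , (λ ())
  colour₄-locally-distinct (x₄ , i) = (λ ()) , (λ ()) , (λ ())
  colour₄-locally-distinct (x₅ , i) = (λ ()) , (λ ()) , (λ ())
  colour₄-locally-distinct (x₆ , i) = (λ ()) , (λ ()) , (λ ())
  colour₄-locally-distinct (w  , i) = (λ ()) , (λ ()) , λ eq → loopColour-next (prev i) (begin
    loopColour (prev i)         ≡⟨ wColour-other i (prev i) (next-≢-prev i ∘ sym) ⟨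
    wColour i (prev i)          ≡⟨ suc-injective eq ⟨
    wColour i (next i)          ≡⟨ wColour-next i ⟩
    loopColour i                ≡⟨ cong loopColour (next-prev i) ⟨
    loopColour (next (prev i))  ∎)
    where open ≡-Reasoning

  four-colourable : EdgeColourable Adj 4
  four-colourable =
    colour₄ , colour₄-symmetric , locally-distinct⇒proper colour₄ colour₄-locally-distinct

  -- No 3-edge-colouring

  module _ (col : Vα m → Vα m → Fin 3) (col-sym : ∀ x y → Adj x y → col x y ≡ col y x)
           (col-proper : Proper col) where

    private
      local : LocallyDistinct col
      local = proper⇒locally-distinct col col-proper

      reverse : ∀ {u u'} → GEdge u u' → ∀ j → col (u' , j) (u , j) ≡ col (u , j) (u' , j)
      reverse e j = col-sym _ _ (inj₂ (internal e j))

      out≡in : ∀ {p q} → (∀ j → Eα m a a a (p , j) (q , next j)) →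
        ∀ j → col (p , j) (q , next j) ≡ col (q , next j) (p , prev (next j))
      out≡in {p} {q} edge j = begin
        col (p , j) (q , next j)                ≡⟨ col-sym _ _ (inj₁ (edge j)) ⟩
        col (q , next j) (p , j)                ≡⟨ cong (λ k → col (q , next j) (p , k)) (prev-next j) ⟨
        col (q , next j) (p , prev (next j))    ∎
        where open ≡-Reasoning

    inA inB inW : Fin m → Fin 3
    inA j = col (A , j) (A' , prev j)
    inB j = col (B , j) (B' , prev j)
    inW j = col (w , j) (w , prev j)

    twistIn : Fin m → Bool
    twistIn j = twist (inA j) (inB j) (inW j)

    twistIn-next : ∀ j → twistIn (next j) ≡ not (twistIn j)
    twistIn-next j = ¬-not (twist-reversal _ _ _ at-A _ _ _ at-A' _ at-v _ _ at-w)
      where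
      crossed : col (x₆ , j) (A , j) ≡ inB (next j) × col (x₃ , j) (A' , j) ≡ inB j
      crossed = B-colours-cross
        _ _ _ (local (x₆ , j))
        _ _   (Distinct₃-cong (reverse e-x6x2 j) refl refl (local (x₂ , j)))
        _ _   (Distinct₃-cong (reverse e-x2x4 j) refl refl (local (x₄ , j)))
        _ _   (Distinct₃-cong (reverse e-x4x3 j) refl refl (local (x₃ , j)))
        _     (Distinct₃-cong (reverse e-x6x5 j) (reverse e-x3x5 j) refl (local (x₅ , j)))
        _ _   (Distinct₃-cong (reverse e-x5x1 j) refl refl (local (x₁ , j)))
        _     (Distinct₃-cong (reverse e-x2B j) (reverse e-x1B j) refl (local (B , j)))
        _     (Distinct₃-cong (reverse e-x4B' j) (reverse e-x1B' j) (out≡in connB j) (local (B' , j)))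
      at-A : Distinct₃ (col (A , j) (v , j)) (inB (next j)) (inA j)
      at-A = Distinct₃-cong refl (trans (sym (reverse e-Ax6 j)) (proj₁ crossed)) refl (local (A , j))
      at-A' : Distinct₃ (col (A' , j) (v , j)) (inB j) (inA (next j))
      at-A' = Distinct₃-cong refl (trans (reverse e-x3A' j) (proj₂ crossed)) (out≡in connA j) (local (A' , j))
      at-v : Distinct₃ (col (A , j) (v , j)) (col (A' , j) (v , j)) (col (v , j) (w , j))
      at-v = Distinct₃-cong (reverse e-Av j) (sym (reverse e-vA' j)) refl (local (v , j))
      at-w : Distinct₃ (col (v , j) (w , j)) (inW (next j)) (inW j)
      at-w = Distinct₃-cong (col-sym _ _ (inj₂ (spoke j))) (out≡in loopE j) refl (local (w , j))

  not-three-colourable : m % 2 ≡ 1 → ¬ EdgeColourable Adj 3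
  not-three-colourable m-odd (col , col-sym , col-proper) =
    odd-iterate-≢ next (twistIn col col-sym col-proper) (twistIn-next col col-sym col-proper)
      m m-odd i₀ (next-period i₀)
    where
    i₀ : Fin m
    i₀ = 0 mod m

  snark : m % 2 ≡ 1 → Snark Adj
  snark m-odd = loopless , cubic , four-colourable , not-three-colourable m-odd

corollary4 : (m : ℕ) .{{_ : NonZero m}} → 3 ≤ m → m % 2 ≡ 1 →
    (a : ℕ) → 1 ≤ a → 2 * a < m → gcd m a ≡ 1 →
    Snark (Gα m a a a)
corollary4 m _ m-odd a 0<a 2a<m _ = snark m a 0<a 2a<m m-odd
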